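{- Let $n\ge 3$ and let $q$ be an integer with $1<q<n$. Consider a heap-ordered rooted tree with at most $n$ nodes and distinct keys. For a node $x$ let $r(x)$ be the number of nodes with a smaller key, and for a non-root node $x$ with parent $p(x)$ let $rd(x)=r(x)-r(p(x))\ (\ge 1)$; set $rd(\text{root})=0$. For a non-root node $x$ let $c(x)=\lfloor \log_q rd(x)\rfloor$ and $$\phi(x)=\frac{rd(x)-q^{c}}{q^{c}-q^{c-1}}+c\cdot q,\qquad c=c(x),$$ and let $\phi(\text{root})=0$, $\Phi_N=\sum_x \phi(x)$ over all nodes, and $t=\lfloor \log_q (n-1)\rfloor+1$. Then: (i) If $x,y$ are non-root nodes with $rd(y)=rd(x)+1$ and $rd(x)\ge 1$, then $\phi(y)=\phi(x)+1/(q^{c}-q^{c-1})$, where $c=c(x)$. (ii) For every node $x$, $0\le \phi(x)\le t\cdot q$, and therefore $\Phi_N\le n\cdot t\cdot q$. (iii) If two non-root nodes $x,y$ that are children of the same node and have the same category $c(x)=c(y)$ are linked (the one with the larger key becoming a child of the one with the smaller key, all other parent relations and all ranks unchanged), then $\Phi_N$ decreases by at least $1$.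
   Context: Ranks $r(\cdot)$ take distinct values in $\{0,\dots,n-1\}$, so $1\le rd(x)\le n-1$ for non-root nodes; $c(x)$ is the unique integer with $q^{c}\le rd(x)<q^{c+1}$ and satisfies $0\le c(x)<t$. A link of two sibling nodes $x<y$ (by key) makes $y$ a child of $x$, so that the new rank-difference of $y$ becomes $rd(y)-rd(x)$, while the rank-differences of all other nodes are unchanged. -}

module Defs where

open import Data.Nat as ℕ using (ℕ; zero; suc; _<ᵇ_; _^_; _∸_; _<?_)
open import Data.Nat.DivMod using (_/_)
open import Data.Bool using (if_then_else_)
open import Data.Fin using (Fin) renaming (zero to fzero; suc to fsuc)
open import Data.List using (length; filter; allFin)
open import Data.Maybe using (Maybe; just; nothing)
open import Data.Product using (∃-syntax)
open import Data.Integer using (+_)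
open import Data.Rational as ℚ using (ℚ; 0ℚ; _+_; _-_; _÷_; ≢-nonZero)
open import Data.Rational.Properties using (_≟_)
open import Relation.Nullary using (yes; no)
open import Relation.Binary.PropositionalEquality using (_≡_; _≢_)

toℚ : ℕ → ℚ
toℚ n = (+ n) ℚ./ 1

-- division of rationals, total: returns 0 when the divisor is 0
-- (never happens in the statement, since all divisors there are nonzero for q ≥ 2)
_÷'_ : ℚ → ℚ → ℚ
p ÷' r with r ≟ 0ℚ
... | yes _ = 0ℚ
... | no r≢0 = _÷_ p r {{≢-nonZero r≢0}}

-- ⌊log_q m⌋ for q ≥ 2 and m ≥ 1, computed with fuel:
--   ⌊log_q m⌋ = 0 if m < q, and 1 + ⌊log_q ⌊m/q⌋⌋ otherwise.
-- (fuel m suffices; junk value 0 for q < 2)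
logGo : ℕ → ℕ → ℕ → ℕ
logGo zero _ _ = 0
logGo (suc f) q@(suc (suc k)) m = if m <ᵇ q then 0 else suc (logGo f q (m / q))
logGo (suc f) _ _ = 0

⌊log_⌋ : ℕ → ℕ → ℕ
⌊log q ⌋ m = logGo m q m

category : ℕ → ℕ → ℕ
category q d = ⌊log q ⌋ d

-- potential of a non-root node with rank-difference d:
--   (d - q^c) / (q^c - q^(c-1)) + c·q,   c = ⌊log_q d⌋,  q^(c-1) = q^c / q (rational)
phiVal : ℕ → ℕ → ℚ
phiVal q d =
  ((toℚ d - toℚ (q ^ c)) ÷' (toℚ (q ^ c) - (toℚ (q ^ c) ÷' toℚ q))) + toℚ (c ℕ.* q)
  where c = category q d

-- A heap-ordered rooted tree on the nodes Fin m with keys `key`: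
-- a unique root without parent, every other node has a parent with smaller key.
-- (Heap order makes the parent relation acyclic, so this is a rooted tree.)
record HeapTree (m : ℕ) (key : Fin m → ℕ) : Set where
  field
    root : Fin m
    parent : Fin m → Maybe (Fin m)
    root-parent : parent root ≡ nothing
    nonroot-parent : ∀ x → x ≢ root → ∃[ p ] parent x ≡ just p
    heap : ∀ x p → parent x ≡ just p → key p ℕ.< key x

open HeapTree public

rank : ∀ {m} → (Fin m → ℕ) → Fin m → ℕ
rank {m} key x = length (filter (λ y → key y <? key x) (allFin m))

rd : ∀ {m key} → HeapTree m key → Fin m → ℕ
rd {key = key} T x with parent T x
... | nothing = 0
... | just p = rank key x ∸ rank key p

cat : ∀ {m key} → ℕ → HeapTree m key → Fin m → ℕ
cat q T x = category q (rd T x)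

φ : ∀ {m key} → ℕ → HeapTree m key → Fin m → ℚ
φ q T x with parent T x
... | nothing = 0ℚ
... | just _ = phiVal q (rd T x)

sumFin : ∀ m → (Fin m → ℚ) → ℚ
sumFin zero f = 0ℚ
sumFin (suc m) f = f fzero + sumFin m (λ i → f (fsuc i))

Φ : ∀ {m key} → ℕ → HeapTree m key → ℚ
Φ {m} q T = sumFin m (φ q T)

tPar : ℕ → ℕ → ℕ
tPar n q = suc (⌊log q ⌋ (n ∸ 1))

module Submission where

-- Write q = k + 2 and, for a rank-difference d ≥ 1, let c = ⌊log_q d⌋ be its category,
-- width c = q^(c+1) - q^c and slope c = q / width c = 1 / (q^c - q^(c-1)).  The whole
-- argument rests on the closed form
--     phiVal q d = (d - q^c) · slope c + c·q,
-- i.e. the potential is piecewise linear in d with slope (slope c) on category c, and it is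
-- continuous across categories: at d = q^(c+1) both formulas give (c+1)·q.  Hence
--   (i)   each step d ↦ d + 1 adds slope c                                  (phiVal-step);
--   (ii)  0 ≤ phiVal q d ≤ (c+1)·q, and c ≤ ⌊log_q (n-1)⌋ because d ≤ n - 1  (phiVal-bounds);
--   (iii) slopes decrease with the category, so climbing from rd(y) - rd(x) to rd(y) adds at
--         least rd(x) · slope c ≥ q^c · slope c = q/(q-1) ≥ 1                 (phiVal-link).

open import Defs
open import Data.Nat using (ℕ)
open import Data.Fin using (Fin)

module Rationals where

  open import Data.Nat as ℕ using (ℕ; suc)
  import Data.Nat.Properties as ℕ
  open import Data.Nat.Coprimality as Coprime using (1-coprimeTo)
  open import Data.Integer as ℤ using (+_; +≤+)
  import Data.Integer.Properties as ℤ
  open import Data.Rational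
    using (ℚ; mkℚ; 0ℚ; 1ℚ; _+_; _*_; _-_; 1/_; _≤_; *≤*; NonZero; Positive; nonNegative; ≢-nonZero)
  import Data.Rational.Properties as ℚ
  open import Data.Rational.Solver using (module +-*-Solver)
  open +-*-Solver
  open import Data.Empty using (⊥-elim)
  open import Relation.Nullary using (yes; no)
  open import Relation.Binary.PropositionalEquality

  toℚ-canonical : ∀ n → toℚ n ≡ mkℚ (+ n) 0 (Coprime.sym (1-coprimeTo n))
  toℚ-canonical n = ℚ.normalize-coprime (Coprime.sym (1-coprimeTo n))

  toℚ-+ : ∀ m n → toℚ (m ℕ.+ n) ≡ toℚ m + toℚ n
  toℚ-+ m n rewrite toℚ-canonical m | toℚ-canonical n =
    sym (ℚ./-cong {+ m ℤ.* + 1 ℤ.+ + n ℤ.* + 1} {1} {+ (m ℕ.+ n)} {1}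
      (cong₂ ℤ._+_ (ℤ.*-identityʳ (+ m)) (ℤ.*-identityʳ (+ n))) refl)

  toℚ-* : ∀ m n → toℚ (m ℕ.* n) ≡ toℚ m * toℚ n
  toℚ-* m n rewrite toℚ-canonical m | toℚ-canonical n =
    sym (ℚ./-cong {+ m ℤ.* + n} {1} {+ (m ℕ.* n)} {1} (ℤ.+◃n≡+n (m ℕ.* n)) refl)

  toℚ-mono : ∀ {m n} → m ℕ.≤ n → toℚ m ≤ toℚ n
  toℚ-mono {m} {n} m≤n rewrite toℚ-canonical m | toℚ-canonical n =
    *≤* (subst₂ ℤ._≤_ (sym (ℤ.*-identityʳ (+ m))) (sym (ℤ.*-identityʳ (+ n))) (+≤+ m≤n))

  toℚ-∸ : ∀ {m n} → n ℕ.≤ m → toℚ (m ℕ.∸ n) ≡ toℚ m - toℚ n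
  toℚ-∸ {m} {n} n≤m = begin
    toℚ (m ℕ.∸ n)                     ≡⟨ solve 2 (λ x y → x := (x :+ y) :- y) refl (toℚ (m ℕ.∸ n)) (toℚ n) ⟩
    (toℚ (m ℕ.∸ n) + toℚ n) - toℚ n   ≡⟨ cong (_- toℚ n) (sym (toℚ-+ (m ℕ.∸ n) n)) ⟩
    toℚ (m ℕ.∸ n ℕ.+ n) - toℚ n       ≡⟨ cong (λ z → toℚ z - toℚ n) (ℕ.m∸n+n≡m n≤m) ⟩
    toℚ m - toℚ n                     ∎
    where open ≡-Reasoning

  toℚ-positive : ∀ {n} → 1 ℕ.≤ n → Positive (toℚ n)
  toℚ-positive {suc n} _ = subst Positive (sym (toℚ-canonical (suc n))) _

  scale-mono : ∀ {m n} s → 0ℚ ≤ s → m ℕ.≤ n → toℚ m * s ≤ toℚ n * s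
  scale-mono s 0≤s m≤n = ℚ.*-monoʳ-≤-nonNeg s {{nonNegative 0≤s}} (toℚ-mono m≤n)

  recip : (n : ℕ) → 1 ℕ.≤ n → ℚ
  recip n 1≤n = (1/ toℚ n) {{ℚ.pos⇒nonZero (toℚ n) {{toℚ-positive 1≤n}}}}

  recip-inverse : ∀ n (1≤n : 1 ℕ.≤ n) → toℚ n * recip n 1≤n ≡ 1ℚ
  recip-inverse n 1≤n = ℚ.*-inverseʳ (toℚ n) {{ℚ.pos⇒nonZero (toℚ n) {{toℚ-positive 1≤n}}}}

  recip-nonNeg : ∀ n (1≤n : 1 ℕ.≤ n) → 0ℚ ≤ recip n 1≤n
  recip-nonNeg n 1≤n = ℚ.nonNegative⁻¹ (recip n 1≤n) {{ℚ.pos⇒nonNeg (recip n 1≤n) {{ℚ.1/pos⇒pos (toℚ n) {{toℚ-positive 1≤n}}}}}}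

  inverse-unique : ∀ r {s} .{{_ : NonZero r}} → r * s ≡ 1ℚ → 1/ r ≡ s
  inverse-unique r {s} rs≡1 = begin
    1/ r              ≡⟨ sym (ℚ.*-identityʳ (1/ r)) ⟩
    1/ r * 1ℚ         ≡⟨ cong (1/ r *_) (sym rs≡1) ⟩
    1/ r * (r * s)    ≡⟨ sym (ℚ.*-assoc (1/ r) r s) ⟩
    (1/ r * r) * s    ≡⟨ cong (_* s) (ℚ.*-inverseˡ r) ⟩
    1ℚ * s            ≡⟨ ℚ.*-identityˡ s ⟩
    s                 ∎
    where open ≡-Reasoning

  ÷'-by-inverse : ∀ p {r s} → r * s ≡ 1ℚ → p ÷' r ≡ p * s
  ÷'-by-inverse p {r} {s} rs≡1 with r ℚ.≟ 0ℚ
  ... | yes refl = ⊥-elim (ℚ.1≢0 (trans (sym rs≡1) (ℚ.*-zeroˡ s)))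
  ... | no r≢0 = cong (p *_) (inverse-unique r {{≢-nonZero r≢0}} rs≡1)

  inverse-antitone : ∀ {p r p' r'} → 0ℚ ≤ p' → 0ℚ ≤ r' → p ≤ r →
                     p * p' ≡ 1ℚ → r * r' ≡ 1ℚ → r' ≤ p'
  inverse-antitone {p} {r} {p'} {r'} 0≤p' 0≤r' p≤r pp'≡1 rr'≡1 = begin
    r'                 ≡⟨ sym (ℚ.*-identityˡ r') ⟩
    1ℚ * r'            ≡⟨ cong (_* r') (sym pp'≡1) ⟩
    (p * p') * r'      ≡⟨ ℚ.*-assoc p p' r' ⟩
    p * (p' * r')      ≤⟨ ℚ.*-monoʳ-≤-nonNeg (p' * r') {{nonNegative 0≤p'r'}} p≤r ⟩
    r * (p' * r')      ≡⟨ solve 3 (λ r p' r' → r :* (p' :* r') := (r :* r') :* p') refl r p' r' ⟩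
    (r * r') * p'      ≡⟨ cong (_* p') rr'≡1 ⟩
    1ℚ * p'            ≡⟨ ℚ.*-identityˡ p' ⟩
    p'                 ∎
    where
    open ℚ.≤-Reasoning
    0≤p'r' : 0ℚ ≤ p' * r'
    0≤p'r' = ℚ.nonNegative⁻¹ _ {{ℚ.nonNeg*nonNeg⇒nonNeg p' {{nonNegative 0≤p'}} r' {{nonNegative 0≤r'}}}}

module Category (k : ℕ) where

  open import Data.Nat
    using (ℕ; zero; suc; _+_; _*_; _^_; _≤_; _<_; _<ᵇ_; z≤n; s≤s; >-nonZero)
  open import Data.Nat.Properties
  open import Data.Nat.DivMod using (_/_; _%_; m≡m%n+[m/n]*n; m%n<n; m/n*n≤m; m/n<m; m≥n⇒m/n>0)
  open import Data.Bool using (true; false; T)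
  open import Data.Product using (_×_; _,_; proj₁; proj₂)
  open import Relation.Nullary using (contradiction)
  open import Relation.Binary.PropositionalEquality

  q : ℕ
  q = suc (suc k)

  logGo-bracket : ∀ f d → 1 ≤ d → d ≤ f → q ^ logGo f q d ≤ d × d < q ^ suc (logGo f q d)
  logGo-bracket zero    d 1≤d d≤0 = contradiction (≤-trans 1≤d d≤0) λ ()
  logGo-bracket (suc f) d 1≤d d≤f+1 with d <ᵇ q in d<ᵇq
  ... | true  = 1≤d , subst (d <_) (sym (*-identityʳ q)) (<ᵇ⇒< d q (subst T (sym d<ᵇq) _))
  ... | false = lower , upper
    where
    q≤d : q ≤ d
    q≤d = ≮⇒≥ (λ d<q → subst T d<ᵇq (<⇒<ᵇ d<q))
    d/q<d : d / q < d
    d/q<d = m/n<m d q {{>-nonZero 1≤d}} (s≤s (s≤s z≤n))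
    L : ℕ
    L = logGo f q (d / q)
    ih : q ^ L ≤ d / q × d / q < q ^ suc L
    ih = logGo-bracket f (d / q) (m≥n⇒m/n>0 q≤d) (≤-pred (≤-trans d/q<d d≤f+1))
    lower : q * q ^ L ≤ d
    lower = ≤-trans (*-monoʳ-≤ q (proj₁ ih)) (subst (_≤ d) (*-comm (d / q) q) (m/n*n≤m d q))
    upper : d < q * q ^ suc L
    upper = begin-strict
      d                   ≡⟨ m≡m%n+[m/n]*n d q ⟩
      d % q + d / q * q   <⟨ +-monoˡ-< (d / q * q) (m%n<n d q) ⟩
      suc (d / q) * q     ≤⟨ *-monoˡ-≤ q (proj₂ ih) ⟩
      q ^ suc L * q       ≡⟨ *-comm (q ^ suc L) q ⟩
      q * q ^ suc L       ∎
      where open ≤-Reasoning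

  category-bracket : ∀ d → 1 ≤ d → q ^ category q d ≤ d × d < q ^ suc (category q d)
  category-bracket d 1≤d = logGo-bracket d d 1≤d ≤-refl

  ^-reflects-< : ∀ {a b} → q ^ a < q ^ b → a < b
  ^-reflects-< {a} {b} qᵃ<qᵇ = ≰⇒> (λ b≤a → <⇒≱ qᵃ<qᵇ (^-monoʳ-≤ q b≤a))

  category-unique : ∀ {c d} → q ^ c ≤ d → d < q ^ suc c → category q d ≡ c
  category-unique {c} {d} qᶜ≤d d<qᶜ⁺¹ = ≤-antisym
    (≤-pred (^-reflects-< (≤-<-trans (proj₁ bracket) d<qᶜ⁺¹)))
    (≤-pred (^-reflects-< (≤-<-trans qᶜ≤d (proj₂ bracket))))
    where
    bracket : q ^ category q d ≤ d × d < q ^ suc (category q d)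
    bracket = category-bracket d (≤-trans (m^n>0 q c) qᶜ≤d)

  category-mono : ∀ {d d'} → 1 ≤ d → d ≤ d' → category q d ≤ category q d'
  category-mono {d} {d'} 1≤d d≤d' = ≤-pred (^-reflects-<
    (≤-<-trans (≤-trans (proj₁ (category-bracket d 1≤d)) d≤d')
               (proj₂ (category-bracket d' (≤-trans 1≤d d≤d')))))

module Potential (k : ℕ) where

  open Rationals
  open Category k
  open import Data.Nat as ℕ using (ℕ; zero; suc; _^_; _∸_; z≤n; s≤s)
  import Data.Nat.Properties as ℕ
  open import Data.Rational using (ℚ; 0ℚ; 1ℚ; _+_; _*_; _-_; _≤_; nonNegative)
  import Data.Rational.Properties as ℚ
  open import Data.Rational.Solver using (module +-*-Solver)
  open +-*-Solver
  open import Data.Product using (_×_; _,_; proj₁; proj₂)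
  open import Relation.Nullary using (Dec; yes; no)
  open import Relation.Binary.PropositionalEquality

  -- the number of rank-differences in category c; q * q ^ c = q ^ c + width c by computation
  width : ℕ → ℕ
  width c = suc k ℕ.* q ^ c

  width-positive : ∀ c → 1 ℕ.≤ width c
  width-positive c = ℕ.*-mono-≤ (s≤s (z≤n {k})) (ℕ.m^n>0 q c)

  widthInv : ℕ → ℚ
  widthInv c = recip (width c) (width-positive c)

  width-widthInv : ∀ c → toℚ (width c) * widthInv c ≡ 1ℚ
  width-widthInv c = recip-inverse (width c) (width-positive c)

  widthInv-nonNeg : ∀ c → 0ℚ ≤ widthInv c
  widthInv-nonNeg c = recip-nonNeg (width c) (width-positive c)

  slope : ℕ → ℚ
  slope c = toℚ q * widthInv c

  slope-nonNeg : ∀ c → 0ℚ ≤ slope c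
  slope-nonNeg c = subst (_≤ slope c) (ℚ.*-zeroˡ (widthInv c)) (scale-mono (widthInv c) (widthInv-nonNeg c) (z≤n {q}))

  width-slope : ∀ c → toℚ (width c) * slope c ≡ toℚ q
  width-slope c = begin
    w * (toℚ q * widthInv c)   ≡⟨ solve 3 (λ w a r → w :* (a :* r) := a :* (w :* r)) refl w (toℚ q) (widthInv c) ⟩
    toℚ q * (w * widthInv c)   ≡⟨ cong (toℚ q *_) (width-widthInv c) ⟩
    toℚ q * 1ℚ                 ≡⟨ ℚ.*-identityʳ (toℚ q) ⟩
    toℚ q                      ∎
    where open ≡-Reasoning
          w : ℚ
          w = toℚ (width c)

  slope-antitone : ∀ {c' c} → c' ℕ.≤ c → slope c ≤ slope c'
  slope-antitone {c'} {c} c'≤c = ℚ.*-monoˡ-≤-nonNeg (toℚ q) {{nonNegative (toℚ-mono (z≤n {q}))}}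
    (inverse-antitone (widthInv-nonNeg c') (widthInv-nonNeg c)
      (toℚ-mono (ℕ.*-monoʳ-≤ (suc k) (ℕ.^-monoʳ-≤ q c'≤c)))
      (width-widthInv c') (width-widthInv c))

  -- q ^ c steps at slope c raise the potential by q / (q - 1) ≥ 1
  slope-power : ∀ c → 1ℚ ≤ toℚ (q ^ c) * slope c
  slope-power c = begin
    1ℚ                      ≡⟨ sym (width-widthInv c) ⟩
    toℚ (width c) * r       ≤⟨ scale-mono r (widthInv-nonNeg c) (ℕ.m≤n+m (width c) (q ^ c)) ⟩
    toℚ (q ℕ.* q ^ c) * r   ≡⟨ cong (_* r) (toℚ-* q (q ^ c)) ⟩
    toℚ q * toℚ (q ^ c) * r ≡⟨ solve 3 (λ a Q r → a :* Q :* r := Q :* (a :* r)) refl (toℚ q) (toℚ (q ^ c)) r ⟩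
    toℚ (q ^ c) * slope c   ∎
    where open ℚ.≤-Reasoning
          r : ℚ
          r = widthInv c

  span : ℕ → ℚ
  span c = toℚ (q ^ c) - (toℚ (q ^ c) ÷' toℚ q)

  span-slope : ∀ c → span c * slope c ≡ 1ℚ
  span-slope c = begin
    span c * slope c                  ≡⟨ cong (λ z → (Q - z) * slope c) (÷'-by-inverse Q {toℚ q} (recip-inverse q (s≤s z≤n))) ⟩
    (Q - Q * q⁻¹) * (toℚ q * r)       ≡⟨ solve 4 (λ Q i a r → (Q :- Q :* i) :* (a :* r) := (a :* Q :- Q :* (a :* i)) :* r)
                                           refl Q q⁻¹ (toℚ q) r ⟩
    (toℚ q * Q - Q * (toℚ q * q⁻¹)) * r ≡⟨ cong₂ (λ u v → (u - Q * v) * r) (sym (toℚ-* q (q ^ c))) (recip-inverse q (s≤s z≤n)) ⟩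
    (toℚ (q ℕ.* q ^ c) - Q * 1ℚ) * r  ≡⟨ cong (λ u → (u - Q * 1ℚ) * r) (toℚ-+ (q ^ c) (width c)) ⟩
    (Q + toℚ (width c) - Q * 1ℚ) * r  ≡⟨ solve 3 (λ Q w r → (Q :+ w :- Q :* con 1ℚ) :* r := w :* r) refl Q (toℚ (width c)) r ⟩
    toℚ (width c) * r                 ≡⟨ width-widthInv c ⟩
    1ℚ                                ∎
    where open ≡-Reasoning
          Q : ℚ
          Q = toℚ (q ^ c)
          q⁻¹ : ℚ
          q⁻¹ = recip q (s≤s z≤n)
          r : ℚ
          r = widthInv c

  span-reciprocal : ∀ c → toℚ 1 ÷' span c ≡ slope c
  span-reciprocal c = trans (÷'-by-inverse (toℚ 1) {span c} (span-slope c)) (ℚ.*-identityˡ (slope c))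

  potAt : ℕ → ℕ → ℚ
  potAt c j = toℚ j * slope c + toℚ (c ℕ.* q)

  potAt-suc : ∀ c j → potAt c (suc j) ≡ potAt c j + slope c
  potAt-suc c j = begin
    toℚ (1 ℕ.+ j) * slope c + C    ≡⟨ cong (λ z → z * slope c + C) (toℚ-+ 1 j) ⟩
    (1ℚ + toℚ j) * slope c + C     ≡⟨ solve 3 (λ J s C → (con 1ℚ :+ J) :* s :+ C := J :* s :+ C :+ s) refl (toℚ j) (slope c) C ⟩
    toℚ j * slope c + C + slope c  ∎
    where open ≡-Reasoning
          C : ℚ
          C = toℚ (c ℕ.* q)

  potAt-zero : ∀ c → potAt c 0 ≡ toℚ (c ℕ.* q)
  potAt-zero c = trans (cong (_+ toℚ (c ℕ.* q)) (ℚ.*-zeroˡ (slope c))) (ℚ.+-identityˡ _)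

  -- the end of category c is the start of category c + 1: the potential is continuous
  potAt-full : ∀ c → potAt c (width c) ≡ toℚ (suc c ℕ.* q)
  potAt-full c = trans (cong (_+ toℚ (c ℕ.* q)) (width-slope c)) (sym (toℚ-+ q (c ℕ.* q)))

  potAt-bounds : ∀ c {j} → j ℕ.≤ width c → 0ℚ ≤ potAt c j × potAt c j ≤ toℚ (suc c ℕ.* q)
  potAt-bounds c {j} j≤w =
    ℚ.+-mono-≤ (subst (_≤ toℚ j * slope c) (ℚ.*-zeroˡ (slope c)) (scale-mono (slope c) (slope-nonNeg c) (z≤n {j})))
               (toℚ-mono (z≤n {c ℕ.* q})) ,
    subst (potAt c j ≤_) (potAt-full c) (ℚ.+-monoˡ-≤ (toℚ (c ℕ.* q)) (scale-mono (slope c) (slope-nonNeg c) j≤w))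

  phiVal-closed : ∀ {d} → 1 ℕ.≤ d → phiVal q d ≡ potAt (category q d) (d ∸ q ^ category q d)
  phiVal-closed {d} 1≤d = begin
    (toℚ d - toℚ (q ^ c)) ÷' span c + C     ≡⟨ cong (_+ C) (÷'-by-inverse (toℚ d - toℚ (q ^ c)) {span c} (span-slope c)) ⟩
    (toℚ d - toℚ (q ^ c)) * slope c + C     ≡⟨ cong (λ z → z * slope c + C) (sym (toℚ-∸ (proj₁ (category-bracket d 1≤d)))) ⟩
    toℚ (d ∸ q ^ c) * slope c + C           ∎
    where open ≡-Reasoning
          c : ℕ
          c = category q d
          C : ℚ
          C = toℚ (c ℕ.* q)

  -- one more unit of rank-difference either stays in category c or reaches exactly
  -- q ^ (c + 1), the start of category c + 1; by continuity the closed form goes on linearly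
  phiVal-suc-closed : ∀ {d} → 1 ℕ.≤ d →
    phiVal q (suc d) ≡ potAt (category q d) (suc (d ∸ q ^ category q d))
  phiVal-suc-closed {d} 1≤d = by-cases (suc d ℕ.<? q ^ suc c)
    where
    open ≡-Reasoning
    c : ℕ
    c = category q d
    lower : q ^ c ℕ.≤ d
    lower = proj₁ (category-bracket d 1≤d)
    by-cases : Dec (suc d ℕ.< q ^ suc c) → phiVal q (suc d) ≡ potAt c (suc (d ∸ q ^ c))
    by-cases (yes sd<qᶜ⁺¹) = trans (phiVal-closed {suc d} (s≤s z≤n)) (cong₂ potAt same-category offset)
      where
      same-category : category q (suc d) ≡ c
      same-category = category-unique (ℕ.m≤n⇒m≤1+n lower) sd<qᶜ⁺¹
      offset : suc d ∸ q ^ category q (suc d) ≡ suc (d ∸ q ^ c)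
      offset = trans (cong (λ c' → suc d ∸ q ^ c') same-category) (ℕ.+-∸-assoc 1 lower)
    by-cases (no sd≮qᶜ⁺¹) = begin
      phiVal q (suc d)                                             ≡⟨ phiVal-closed {suc d} (s≤s z≤n) ⟩
      potAt (category q (suc d)) (suc d ∸ q ^ category q (suc d))  ≡⟨ cong₂ potAt next-category offset ⟩
      potAt (suc c) 0                                              ≡⟨ potAt-zero (suc c) ⟩
      toℚ (suc c ℕ.* q)                                            ≡⟨ sym (potAt-full c) ⟩
      potAt c (width c)                                            ≡⟨ cong (potAt c) (sym fills) ⟩
      potAt c (suc (d ∸ q ^ c))                                    ∎
      where
      sd≡qᶜ⁺¹ : suc d ≡ q ^ suc c
      sd≡qᶜ⁺¹ = ℕ.≤-antisym (proj₂ (category-bracket d 1≤d)) (ℕ.≮⇒≥ sd≮qᶜ⁺¹)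
      next-category : category q (suc d) ≡ suc c
      next-category = category-unique (ℕ.≤-reflexive (sym sd≡qᶜ⁺¹))
        (subst (ℕ._< q ^ suc (suc c)) (sym sd≡qᶜ⁺¹) (ℕ.^-monoʳ-< q (s≤s (s≤s z≤n)) (ℕ.n<1+n (suc c))))
      offset : suc d ∸ q ^ category q (suc d) ≡ 0
      offset = trans (cong₂ (λ a b → a ∸ q ^ b) sd≡qᶜ⁺¹ next-category) (ℕ.n∸n≡0 (q ^ suc c))
      fills : suc (d ∸ q ^ c) ≡ width c
      fills = begin
        suc (d ∸ q ^ c)           ≡⟨ sym (ℕ.+-∸-assoc 1 lower) ⟩
        suc d ∸ q ^ c             ≡⟨ cong (_∸ q ^ c) sd≡qᶜ⁺¹ ⟩
        q ^ c ℕ.+ width c ∸ q ^ c ≡⟨ ℕ.m+n∸m≡n (q ^ c) (width c) ⟩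
        width c                   ∎

  phiVal-step : ∀ {d} → 1 ℕ.≤ d → phiVal q (suc d) ≡ phiVal q d + slope (category q d)
  phiVal-step {d} 1≤d = begin
    phiVal q (suc d)                ≡⟨ phiVal-suc-closed 1≤d ⟩
    potAt c (suc (d ∸ q ^ c))       ≡⟨ potAt-suc c (d ∸ q ^ c) ⟩
    potAt c (d ∸ q ^ c) + slope c   ≡⟨ cong (_+ slope c) (sym (phiVal-closed 1≤d)) ⟩
    phiVal q d + slope c            ∎
    where open ≡-Reasoning
          c : ℕ
          c = category q d

  phiVal-bounds : ∀ {d} → 1 ℕ.≤ d → 0ℚ ≤ phiVal q d × phiVal q d ≤ toℚ (suc (category q d) ℕ.* q)
  phiVal-bounds {d} 1≤d = subst (λ z → 0ℚ ≤ z × z ≤ toℚ (suc c ℕ.* q)) (sym (phiVal-closed 1≤d))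
    (potAt-bounds c (ℕ.m≤n+o⇒m∸n≤o d (q ^ c) (ℕ.<⇒≤ (proj₂ (category-bracket d 1≤d)))))
    where
      c : ℕ
      c = category q d

  phiVal-accumulate : ∀ {c d} j → 1 ℕ.≤ d → category q (d ℕ.+ j) ℕ.≤ c →
                      phiVal q d + toℚ j * slope c ≤ phiVal q (d ℕ.+ j)
  phiVal-accumulate {c} {d} zero 1≤d _ = ℚ.≤-reflexive (begin
    phiVal q d + toℚ 0 * slope c  ≡⟨ cong (phiVal q d +_) (ℚ.*-zeroˡ (slope c)) ⟩
    phiVal q d + 0ℚ               ≡⟨ ℚ.+-identityʳ (phiVal q d) ⟩
    phiVal q d                    ≡⟨ cong (phiVal q) (sym (ℕ.+-identityʳ d)) ⟩
    phiVal q (d ℕ.+ 0)            ∎)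
    where open ≡-Reasoning
  phiVal-accumulate {c} {d} (suc j) 1≤d cat≤c = begin
    phiVal q d + toℚ (1 ℕ.+ j) * slope c              ≡⟨ cong (λ z → phiVal q d + z * slope c) (toℚ-+ 1 j) ⟩
    phiVal q d + (1ℚ + toℚ j) * slope c               ≡⟨ solve 3 (λ φ J s → φ :+ (con 1ℚ :+ J) :* s := (φ :+ J :* s) :+ s)
                                                           refl (phiVal q d) (toℚ j) (slope c) ⟩
    (phiVal q d + toℚ j * slope c) + slope c          ≤⟨ ℚ.+-mono-≤ (phiVal-accumulate j 1≤d cat≤c') (slope-antitone cat≤c') ⟩
    phiVal q (d ℕ.+ j) + slope (category q (d ℕ.+ j)) ≡⟨ sym (phiVal-step 1≤d+j) ⟩
    phiVal q (suc (d ℕ.+ j))                          ≡⟨ cong (phiVal q) (sym (ℕ.+-suc d j)) ⟩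
    phiVal q (d ℕ.+ suc j)                            ∎
    where
    open ℚ.≤-Reasoning
    1≤d+j : 1 ℕ.≤ d ℕ.+ j
    1≤d+j = ℕ.≤-trans 1≤d (ℕ.m≤m+n d j)
    cat≤c' : category q (d ℕ.+ j) ℕ.≤ c
    cat≤c' = ℕ.≤-trans (category-mono 1≤d+j (ℕ.+-monoʳ-≤ d (ℕ.n≤1+n j))) cat≤c

  phiVal-link : ∀ {a b} → 1 ℕ.≤ b → b ℕ.< a → category q a ≡ category q b →
                phiVal q (a ∸ b) + 1ℚ ≤ phiVal q a
  phiVal-link {a} {b} 1≤b b<a same-category = begin
    phiVal q (a ∸ b) + 1ℚ              ≤⟨ ℚ.+-monoʳ-≤ (phiVal q (a ∸ b)) one≤ ⟩
    phiVal q (a ∸ b) + toℚ b * slope c ≤⟨ phiVal-accumulate b (ℕ.m<n⇒0<n∸m b<a)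
                                             (ℕ.≤-reflexive (trans (cong (category q) a∸b+b≡a) same-category)) ⟩
    phiVal q (a ∸ b ℕ.+ b)             ≡⟨ cong (phiVal q) a∸b+b≡a ⟩
    phiVal q a                         ∎
    where
    open ℚ.≤-Reasoning
    c : ℕ
    c = category q b
    a∸b+b≡a : a ∸ b ℕ.+ b ≡ a
    a∸b+b≡a = ℕ.m∸n+n≡m (ℕ.<⇒≤ b<a)
    one≤ : 1ℚ ≤ toℚ b * slope c
    one≤ = ℚ.≤-trans (slope-power c) (scale-mono (slope c) (slope-nonNeg c) (proj₁ (category-bracket b 1≤b)))

module Ranks where

  open import Data.Nat using (ℕ; _<_; _<?_)
  open import Data.Nat.Properties using (<-irrefl; <-trans; module ≤-Reasoning)
  open import Data.Fin using (Fin)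
  open import Data.List using (List; length; filter; allFin)
  open import Data.List.Properties using (length-tabulate; filter-idem; filter-notAll)
  import Data.List.Relation.Unary.Any as Any
  open import Data.List.Membership.Propositional.Properties using (∈-allFin; ∈-filter⁺)
  open import Data.List.Relation.Binary.Sublist.Propositional using (⊆-refl)
  open import Data.List.Relation.Binary.Sublist.Propositional.Properties using (filter⁺; length-mono-≤)
  open import Function using (id)
  open import Relation.Nullary using (Dec)
  open import Relation.Binary.PropositionalEquality

  -- x itself is not counted in r(x)
  rank-bound : ∀ {m} (key : Fin m → ℕ) x → rank key x < m
  rank-bound {m} key x = subst (rank key x <_) (length-tabulate id)
    (filter-notAll (λ y → key y <? key x) (allFin m) (Any.map (λ { refl → <-irrefl refl }) (∈-allFin x)))

  -- the nodes below a are exactly the nodes below a among those below b, and a is below b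
  rank-mono : ∀ {m} (key : Fin m → ℕ) {a b} → key a < key b → rank key a < rank key b
  rank-mono {m} key {a} {b} ka<kb = begin-strict
    length (filter below-a? xs)                       ≡⟨ cong length (sym (filter-idem below-a? xs)) ⟩
    length (filter below-a? (filter below-a? xs))     ≤⟨ length-mono-≤ (filter⁺ below-a? below-a? (λ { refl → id })
                                                           (filter⁺ below-a? below-b? (λ { refl kz<ka → <-trans kz<ka ka<kb }) (⊆-refl {x = xs}))) ⟩
    length (filter below-a? (filter below-b? xs))     <⟨ filter-notAll below-a? (filter below-b? xs)
                                                           (Any.map (λ { refl → <-irrefl refl }) (∈-filter⁺ below-b? (∈-allFin a) ka<kb)) ⟩
    length (filter below-b? xs)                       ∎
    where
    open ≤-Reasoning
    xs : List (Fin m)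
    xs = allFin m
    below-a? : (y : Fin m) → Dec (key y < key a)
    below-a? = λ y → key y <? key a
    below-b? : (y : Fin m) → Dec (key y < key b)
    below-b? = λ y → key y <? key b

module Sums where

  open import Data.Nat using (ℕ; zero; suc; _*_)
  open import Data.Fin using (Fin) renaming (zero to fzero; suc to fsuc)
  open import Data.Fin.Properties using (suc-injective)
  open import Data.Rational using (ℚ; _+_; _≤_)
  import Data.Rational.Properties as ℚ
  open import Function using (_∘_)
  open import Relation.Binary.PropositionalEquality
  open Rationals using (toℚ-+)

  sumFin-cong : ∀ m {f g : Fin m → ℚ} → (∀ i → f i ≡ g i) → sumFin m f ≡ sumFin m g
  sumFin-cong zero    f≗g = refl
  sumFin-cong (suc m) f≗g = cong₂ _+_ (f≗g fzero) (sumFin-cong m (f≗g ∘ fsuc))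

  sumFin-bounded : ∀ m (f : Fin m → ℚ) B → (∀ i → f i ≤ toℚ B) → sumFin m f ≤ toℚ (m * B)
  sumFin-bounded zero    f B f≤B = ℚ.≤-refl
  sumFin-bounded (suc m) f B f≤B = subst (sumFin (suc m) f ≤_) (sym (toℚ-+ B (m * B)))
    (ℚ.+-mono-≤ (f≤B fzero) (sumFin-bounded m (λ i → f (fsuc i)) B (λ i → f≤B (fsuc i))))

  sumFin-drop : ∀ m (f g : Fin m → ℚ) y δ → g y + δ ≤ f y → (∀ z → z ≢ y → g z ≡ f z) →
                sumFin m g + δ ≤ sumFin m f
  sumFin-drop (suc m) f g fzero δ drop others = begin
    g fzero + S + δ    ≡⟨ ℚ.+-assoc (g fzero) S δ ⟩
    g fzero + (S + δ)  ≡⟨ cong (g fzero +_) (ℚ.+-comm S δ) ⟩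
    g fzero + (δ + S)  ≡⟨ sym (ℚ.+-assoc (g fzero) δ S) ⟩
    g fzero + δ + S    ≤⟨ ℚ.+-monoˡ-≤ S drop ⟩
    f fzero + S        ≡⟨ cong (f fzero +_) (sumFin-cong m (λ i → others (fsuc i) λ ())) ⟩
    sumFin (suc m) f   ∎
    where open ℚ.≤-Reasoning
          S : ℚ
          S = sumFin m (λ i → g (fsuc i))
  sumFin-drop (suc m) f g (fsuc y) δ drop others = begin
    g fzero + S + δ    ≡⟨ ℚ.+-assoc (g fzero) S δ ⟩
    g fzero + (S + δ)  ≤⟨ ℚ.+-mono-≤ (ℚ.≤-reflexive (others fzero λ ()))
                            (sumFin-drop m (λ i → f (fsuc i)) (λ i → g (fsuc i)) y δ drop
                              (λ z z≢y → others (fsuc z) (z≢y ∘ suc-injective))) ⟩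
    sumFin (suc m) f   ∎
    where open ℚ.≤-Reasoning
          S : ℚ
          S = sumFin m (λ i → g (fsuc i))

module TreeFacts {m : ℕ} {key : Fin m → ℕ} where

  open import Data.Nat using (_+_; _∸_; _≤_; _<_; z≤n)
  open import Data.Nat.Properties using (m<n⇒0<n∸m; m∸n≤m; ≤-<-trans; <⇒≤; ∸-+-assoc; ∸-monoˡ-<; m+[n∸m]≡n)
  open import Data.Maybe using (just; nothing)
  open import Data.Product using (proj₂)
  open import Data.Rational using (0ℚ)
  open import Relation.Binary.PropositionalEquality
  open Ranks

  rd-parent : ∀ (T : HeapTree m key) {x p} → parent T x ≡ just p → rd T x ≡ rank key x ∸ rank key p
  rd-parent T eq rewrite eq = refl

  -- heap order makes every rank-difference of a non-root node positive
  rd-positive : ∀ (T : HeapTree m key) {x p} → parent T x ≡ just p → 1 ≤ rd T x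
  rd-positive T {x} {p} eq = subst (1 ≤_) (sym (rd-parent T eq)) (m<n⇒0<n∸m (rank-mono key (heap T x p eq)))

  rd-bound : ∀ (T : HeapTree m key) x → rd T x < m
  rd-bound T x with parent T x
  ... | nothing = ≤-<-trans z≤n (rank-bound key x)
  ... | just p  = ≤-<-trans (m∸n≤m (rank key x) (rank key p)) (rank-bound key x)

  rd-siblings : ∀ (T : HeapTree m key) {x y p} → parent T x ≡ just p → parent T y ≡ just p →
                key x < key y → rd T x < rd T y
  rd-siblings T {x} {y} {p} px py kx<ky = subst₂ _<_ (sym (rd-parent T px)) (sym (rd-parent T py))
    (∸-monoˡ-< (rank-mono key kx<ky) (<⇒≤ (rank-mono key (heap T x p px))))

  rd-relink : ∀ (T T' : HeapTree m key) {x y p} → parent T x ≡ just p → parent T y ≡ just p →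
              parent T' y ≡ just x → rd T' y ≡ rd T y ∸ rd T x
  rd-relink T T' {x} {y} {p} px py y↦x = begin
    rd T' y                                                 ≡⟨ rd-parent T' y↦x ⟩
    rank key y ∸ rank key x                                 ≡⟨ cong (rank key y ∸_) (sym (m+[n∸m]≡n rp≤rx)) ⟩
    rank key y ∸ (rank key p + (rank key x ∸ rank key p))   ≡⟨ sym (∸-+-assoc (rank key y) (rank key p) _) ⟩
    rank key y ∸ rank key p ∸ (rank key x ∸ rank key p)     ≡⟨ sym (cong₂ _∸_ (rd-parent T py) (rd-parent T px)) ⟩
    rd T y ∸ rd T x                                         ∎
    where
    open ≡-Reasoning
    rp≤rx : rank key p ≤ rank key x
    rp≤rx = <⇒≤ (rank-mono key (heap T x p px))

  -- φ(x) for a non-root node; the rank-difference is abstracted as r so that the case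
  -- split on parent T x does not have to unfold phiVal
  φ-parent : ∀ q (T : HeapTree m key) {x p r} → parent T x ≡ just p → rank key x ∸ rank key p ≡ r →
             φ q T x ≡ phiVal q r
  φ-parent q T {x} eq h with parent T x in e
  φ-parent q T {x} refl h | just p = cong (phiVal q) (trans (rd-parent T e) h)

  φ-parent-rd : ∀ q (T : HeapTree m key) {x p} → parent T x ≡ just p → φ q T x ≡ phiVal q (rd T x)
  φ-parent-rd q T px = φ-parent q T px (sym (rd-parent T px))

  φ-nonroot : ∀ q (T : HeapTree m key) {x} → x ≢ root T → φ q T x ≡ phiVal q (rd T x)
  φ-nonroot q T {x} x≢root = φ-parent-rd q T (proj₂ (nonroot-parent T x x≢root))

  φ-root : ∀ q (T : HeapTree m key) {x} → parent T x ≡ nothing → φ q T x ≡ 0ℚ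
  φ-root q T eq rewrite eq = refl

  φ-local : ∀ q (T T' : HeapTree m key) z → parent T' z ≡ parent T z → φ q T' z ≡ φ q T z
  φ-local q T T' z same = by-cases (parent T z) refl
    where
    by-cases : ∀ v → parent T z ≡ v → φ q T' z ≡ φ q T z
    by-cases nothing  e = trans (φ-root q T' (trans same e)) (sym (φ-root q T e))
    by-cases (just p) e = trans (φ-parent q T' (trans same e) refl) (sym (φ-parent q T e refl))

module TreePotential (k : ℕ) {m : ℕ} {key : Fin m → ℕ} (T : HeapTree m key) where

  open Rationals using (toℚ-mono)
  open Category k
  open Potential k
  open TreeFacts
  open Sums
  open import Data.Nat as ℕ using (suc; _∸_; _<_; s≤s; z≤n)
  import Data.Nat.Properties as ℕ
  open import Data.Fin using (_≟_)
  open import Data.Maybe using (just)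
  open import Data.Product using (_×_; _,_; proj₁; proj₂)
  open import Data.Rational using (ℚ; 0ℚ; 1ℚ; _+_; _≤_)
  import Data.Rational.Properties as ℚ
  open import Relation.Nullary using (Dec; yes; no)
  open import Relation.Binary.PropositionalEquality

  φ-step : ∀ x y → x ≢ root T → y ≢ root T → rd T y ≡ suc (rd T x) → 1 ℕ.≤ rd T x →
           φ q T y ≡ φ q T x + (toℚ 1 ÷' span (cat q T x))
  φ-step x y x≢root y≢root rdy≡1+rdx 1≤rdx = begin
    φ q T y                                ≡⟨ φ-nonroot q T y≢root ⟩
    phiVal q (rd T y)                      ≡⟨ cong (phiVal q) rdy≡1+rdx ⟩
    phiVal q (suc (rd T x))                ≡⟨ phiVal-step 1≤rdx ⟩
    phiVal q (rd T x) + slope (cat q T x)  ≡⟨ cong₂ _+_ (sym (φ-nonroot q T x≢root)) (sym (span-reciprocal (cat q T x))) ⟩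
    φ q T x + (toℚ 1 ÷' span (cat q T x))  ∎
    where open ≡-Reasoning

  -- (ii) with at most N + 1 nodes every rank-difference is at most N
  φ-bounded : ∀ {N} → m ℕ.≤ suc N → ∀ x → 0ℚ ≤ φ q T x × φ q T x ≤ toℚ (suc (category q N) ℕ.* q)
  φ-bounded {N} m≤N+1 x = by-cases (x ≟ root T)
    where
    within : ℚ → Set
    within z = 0ℚ ≤ z × z ≤ toℚ (suc (category q N) ℕ.* q)
    by-cases : Dec (x ≡ root T) → within (φ q T x)
    by-cases (yes refl)  = subst within (sym (φ-root q T (root-parent T)))
                             (ℚ.≤-refl , toℚ-mono (z≤n {suc (category q N) ℕ.* q}))
    by-cases (no x≢root) = subst within (sym (φ-nonroot q T x≢root))
                             (proj₁ bounds , ℚ.≤-trans (proj₂ bounds) (toℚ-mono (ℕ.*-monoˡ-≤ q (s≤s (category-mono 1≤d d≤N)))))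
      where
      1≤d : 1 ℕ.≤ rd T x
      1≤d = rd-positive T (proj₂ (nonroot-parent T x x≢root))
      d≤N : rd T x ℕ.≤ N
      d≤N = ℕ.≤-pred (ℕ.≤-trans (rd-bound T x) m≤N+1)
      bounds : 0ℚ ≤ phiVal q (rd T x) × phiVal q (rd T x) ≤ toℚ (suc (category q (rd T x)) ℕ.* q)
      bounds = phiVal-bounds 1≤d

  Φ-bounded : ∀ {N} → m ℕ.≤ suc N → Φ q T ≤ toℚ (m ℕ.* (suc (category q N) ℕ.* q))
  Φ-bounded m≤N+1 = sumFin-bounded m (φ q T) _ (λ x → proj₂ (φ-bounded m≤N+1 x))

  -- (iii) linking y below its sibling x of the same category lowers Φ by at least 1:
  -- only φ(y) changes, from phiVal (rd y) to phiVal (rd y - rd x)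
  Φ-link : ∀ x y → x ≢ root T → parent T x ≡ parent T y → cat q T x ≡ cat q T y → key x < key y →
           (T' : HeapTree m key) → parent T' y ≡ just x → (∀ z → z ≢ y → parent T' z ≡ parent T z) →
           Φ q T' + 1ℚ ≤ Φ q T
  Φ-link x y x≢root siblings same-category kx<ky T' y↦x others =
    sumFin-drop m (φ q T) (φ q T') y 1ℚ drop (λ z z≢y → φ-local q T T' z (others z z≢y))
    where
    open ℚ.≤-Reasoning
    p : Fin m
    p = proj₁ (nonroot-parent T x x≢root)
    px : parent T x ≡ just p
    px = proj₂ (nonroot-parent T x x≢root)
    py : parent T y ≡ just p
    py = trans (sym siblings) px
    drop : φ q T' y + 1ℚ ≤ φ q T y
    drop = begin
      φ q T' y + 1ℚ                    ≡⟨ cong (_+ 1ℚ) (trans (φ-parent-rd q T' y↦x) (cong (phiVal q) (rd-relink T T' px py y↦x))) ⟩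
      phiVal q (rd T y ∸ rd T x) + 1ℚ  ≤⟨ phiVal-link (rd-positive T px) (rd-siblings T px py kx<ky) (sym same-category) ⟩
      phiVal q (rd T y)                ≡⟨ sym (φ-parent-rd q T py) ⟩
      φ q T y                          ∎

open import Data.Nat using (ℕ; suc; _≤_; _<_; _*_; _^_; s≤s)
open import Data.Nat.Properties using (*-monoˡ-≤; *-assoc)
open import Data.Maybe using (just)
open import Data.Product using (_×_; _,_)
open import Data.Rational using (0ℚ; 1ℚ; _+_; _-_) renaming (_≤_ to _≤ℚ_)
import Data.Rational.Properties as ℚ
open import Function.Definitions using (Injective)
open import Relation.Binary.PropositionalEquality using (_≡_; _≢_; subst; sym)

lemma3 : (n q : ℕ) → 3 ≤ n → 1 < q → q < n →
    (m : ℕ) → m ≤ n → (key : Fin m → ℕ) → Injective _≡_ _≡_ key →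
    (T : HeapTree m key) →
    ((x y : Fin m) → x ≢ root T → y ≢ root T →
      rd T y ≡ suc (rd T x) → 1 ≤ rd T x →
      φ q T y ≡ φ q T x + (toℚ 1 ÷' (toℚ (q ^ cat q T x) - (toℚ (q ^ cat q T x) ÷' toℚ q))))
    × (((x : Fin m) → (0ℚ ≤ℚ φ q T x) × (φ q T x ≤ℚ toℚ (tPar n q * q)))
       × (Φ q T ≤ℚ toℚ (n * tPar n q * q)))
    × ((x y : Fin m) → x ≢ root T → y ≢ root T →
      parent T x ≡ parent T y → cat q T x ≡ cat q T y → key x < key y →
      (T' : HeapTree m key) → parent T' y ≡ just x →
      ((z : Fin m) → z ≢ y → parent T' z ≡ parent T z) →
      Φ q T' + 1ℚ ≤ℚ Φ q T)
lemma3 (suc n) (suc (suc k)) (s≤s _) (s≤s (s≤s _)) _ m m≤n key _ T =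
  φ-step , (φ-bounded m≤n , Φ-total) , λ x y x≢root _ → Φ-link x y x≢root
  where
  open Category k using (q)
  open TreePotential k T
  t : ℕ
  t = tPar (suc n) q
  Φ-total : Φ q T ≤ℚ toℚ (suc n * t * q)
  Φ-total = ℚ.≤-trans (Φ-bounded m≤n)
    (Rationals.toℚ-mono (subst (m * (t * q) ≤_) (sym (*-assoc (suc n) t q)) (*-monoˡ-≤ (t * q) m≤n)))
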